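{- Let $(X,\odot,\ell,r)$ be an $\ell r$-multimagma, let $A,B\subseteq X$ and $\mathcal{A}\subseteq\mathcal{P}X$. Then: \begin{enumerate} \item $\ell(r(A))=r(A)$ and $r(\ell(A))=\ell(A)$; \item $\ell(A)\odot A=A$ and $A\odot r(A)=A$; \item $\ell(\bigcup\mathcal{A})=\bigcup\{\ell(C)\mid C\in\mathcal{A}\}$ and $r(\bigcup\mathcal{A})=\bigcup\{r(C)\mid C\in\mathcal{A}\}$; \item $\ell(A\cup B)=\ell(A)\cup\ell(B)$, $r(A\cup B)=r(A)\cup r(B)$, and $\ell(\emptyset)=\emptyset=r(\emptyset)$; \item $f(A)\odot g(B)=g(B)\odot f(A)$ for all $f,g\in\{\ell,r\}$; \item $\ell(A)\subseteq E$ and $r(A)\subseteq E$; \item $\ell(\ell(A)\odot B)=\ell(A)\odot\ell(B)$ and $r(A\odot r(B))=r(A)\odot r(B)$. \end{enumerate}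
   Context: A multimagma is a non-empty set $X$ with $\odot:X\times X\to\mathcal{P}X$, extended to subsets by $A\odot B=\bigcup\{a\odot b\mid a\in A,b\in B\}$. $D_{xy}$ means $x\odot y\neq\emptyset$. An $\ell r$-multimagma is a multimagma with $\ell,r:X\to X$ such that $D_{xy}\Rightarrow r(x)=\ell(y)$, $\ell(x)\odot x=\{x\}$, $x\odot r(x)=\{x\}$ for all $x,y$. For $A\subseteq X$, $\ell(A)=\{\ell(a)\mid a\in A\}$, $r(A)=\{r(a)\mid a\in A\}$. $E=\{x\in X\mid\ell(x)=x\}$ (which equals $\{x\in X\mid r(x)=x\}$). -}

module Defs where

open import Level using (Level; 0ℓ)
open import Data.Product using (Σ; ∃; _×_; _,_)
open import Relation.Binary.PropositionalEquality using (_≡_)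
open import Relation.Unary using (Pred; Satisfiable; ｛_｝; _≐_)

-- An ℓr-multimagma. Subsets of X are predicates Pred X 0ℓ; the power set
-- 𝒫X is Pred X 0ℓ. D_xy (x ⊙ y ≠ ∅) is read constructively as
-- "x ⊙ y is inhabited" (Satisfiable).
record LRMultimagma : Set₁ where
  field
    X        : Set
    nonempty : X
    _⊙_      : X → X → Pred X 0ℓ
    ℓ        : X → X
    r        : X → X
    D⇒r≡ℓ    : ∀ x y → Satisfiable (x ⊙ y) → r x ≡ ℓ y
    ℓ-unit   : ∀ x → (ℓ x ⊙ x) ≐ ｛ x ｝
    r-unit   : ∀ x → (x ⊙ r x) ≐ ｛ x ｝

  D : X → X → Set
  D x y = Satisfiable (x ⊙ y)

  _⊙ˢ_ : Pred X 0ℓ → Pred X 0ℓ → Pred X 0ℓ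
  (A ⊙ˢ B) z = Σ X λ a → Σ X λ b → A a × B b × (a ⊙ b) z

  img : ∀ {a} → (X → X) → Pred X a → Pred X a
  img f A y = Σ X λ a → A a × f a ≡ y

  ℓˢ rˢ : ∀ {a} → Pred X a → Pred X a
  ℓˢ A = img ℓ A
  rˢ A = img r A

  E : Pred X 0ℓ
  E x = ℓ x ≡ x

  ⋃ : Pred (Pred X 0ℓ) 0ℓ → Pred X _
  ⋃ 𝒜 x = Σ (Pred X 0ℓ) λ C → 𝒜 C × C x

  ⋃img : (Pred X 0ℓ → Pred X 0ℓ) → Pred (Pred X 0ℓ) 0ℓ → Pred X _
  ⋃img F 𝒜 x = Σ (Pred X 0ℓ) λ C → 𝒜 C × F C x

-- Units absorb: if ℓ a ⊙ b is inhabited then ℓ a = r (ℓ a) = ℓ b, so ℓ a ⊙ b = ℓ b ⊙ b = {b}.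
-- Together with ℓ(X), r(X) ⊆ E this gives (1), (2), (6) and (7).  Two elements e, e' of E
-- compose only when e = r e = ℓ e' = e', so ⊙ is commutative on subsets of E, which is (5).
-- Items (3) and (4) hold for images under any function.  Every r-statement is the
-- ℓ-statement of the opposite multimagma (x ⊙ᵒᵖ y = y ⊙ x, with ℓ and r exchanged).
module Submission where

open import Defs
open import Level using (0ℓ)
open import Data.Product using (_×_; _,_; proj₁; proj₂)
open import Data.Sum using (_⊎_; inj₁; inj₂)
open import Relation.Binary.PropositionalEquality using (_≡_; refl; sym; trans; cong; subst)
open import Relation.Unary using (Pred; _≐_; _⊆_; _∪_; ∅)
open import Relation.Unary.Properties using (≐-sym; ≐-trans)

opposite : LRMultimagma → LRMultimagma
opposite M = record
  { X        = X
  ; nonempty = nonempty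
  ; _⊙_      = λ x y → y ⊙ x
  ; ℓ        = r
  ; r        = ℓ
  ; D⇒r≡ℓ    = λ x y D-yx → sym (D⇒r≡ℓ y x D-yx)
  ; ℓ-unit   = r-unit
  ; r-unit   = ℓ-unit
  }
  where open LRMultimagma M

module Properties (M : LRMultimagma) where
  open LRMultimagma M

  img-cong : ∀ (f : X → X) {A B : Pred X 0ℓ} → A ≐ B → img f A ≐ img f B
  img-cong f (A⊆B , B⊆A) = (λ (a , Aa , fa≡y) → a , A⊆B Aa , fa≡y)
                         , (λ (a , Ba , fa≡y) → a , B⊆A Ba , fa≡y)

  img-⋃ : ∀ (f : X → X) 𝒜 → img f (⋃ 𝒜) ≐ ⋃img (img f) 𝒜
  img-⋃ f 𝒜 = (λ (a , (C , 𝒜C , Ca) , fa≡y) → C , 𝒜C , a , Ca , fa≡y)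
            , (λ (C , 𝒜C , a , Ca , fa≡y) → a , (C , 𝒜C , Ca) , fa≡y)

  img-∪ : ∀ (f : X → X) (A B : Pred X 0ℓ) → img f (A ∪ B) ≐ (img f A ∪ img f B)
  img-∪ f A B = to , from
    where
    to : img f (A ∪ B) ⊆ (img f A ∪ img f B)
    to (a , inj₁ Aa , fa≡y) = inj₁ (a , Aa , fa≡y)
    to (a , inj₂ Ba , fa≡y) = inj₂ (a , Ba , fa≡y)
    from : (img f A ∪ img f B) ⊆ img f (A ∪ B)
    from (inj₁ (a , Aa , fa≡y)) = a , inj₁ Aa , fa≡y
    from (inj₂ (a , Ba , fa≡y)) = a , inj₂ Ba , fa≡y

  img-∅ : ∀ (f : X → X) → img f ∅ ≐ ∅
  img-∅ f = (λ ()) , λ ()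

  img-absorbs : ∀ {f g : X → X} → (∀ x → g (f x) ≡ f x) →
                (A : Pred X 0ℓ) → img g (img f A) ≐ img f A
  img-absorbs {f} {g} g∘f≗f A =
      (λ { (_ , (a , Aa , refl) , refl) → a , Aa , sym (g∘f≗f a) })
    , (λ { (a , Aa , refl) → f a , (a , Aa , refl) , g∘f≗f a })

  img⊆E : ∀ {f : X → X} → (∀ x → E (f x)) → (A : Pred X 0ℓ) → img f A ⊆ E
  img⊆E f∈E A (a , _ , refl) = f∈E a

  ℓ∈r-fixed : ∀ x → r (ℓ x) ≡ ℓ x
  ℓ∈r-fixed x = D⇒r≡ℓ (ℓ x) x (x , proj₂ (ℓ-unit x) refl)

  ℓ∈E : ∀ x → E (ℓ x)
  ℓ∈E x = trans (cong ℓ (sym (ℓ∈r-fixed x))) (trans ℓr∈E (ℓ∈r-fixed x))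
    where
    ℓr∈E : ℓ (r (ℓ x)) ≡ r (ℓ x)
    ℓr∈E = sym (D⇒r≡ℓ (ℓ x) (r (ℓ x)) (ℓ x , proj₂ (r-unit (ℓ x)) refl))

  ℓ-absorbs : ∀ {a b z} → (ℓ a ⊙ b) z → ℓ a ≡ ℓ b × b ≡ z
  ℓ-absorbs {a} {b} {z} h = ℓa≡ℓb , proj₁ (ℓ-unit b) (subst (λ w → (w ⊙ b) z) ℓa≡ℓb h)
    where
    ℓa≡ℓb : ℓ a ≡ ℓ b
    ℓa≡ℓb = trans (sym (ℓ∈r-fixed a)) (D⇒r≡ℓ (ℓ a) b (z , h))

  E⇒r-fixed : ∀ {e} → E e → r e ≡ e
  E⇒r-fixed {e} ℓe≡e = trans (cong r (sym ℓe≡e)) (trans (ℓ∈r-fixed e) ℓe≡e)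

  E-⊙-self : ∀ {e} → E e → (e ⊙ e) e
  E-⊙-self {e} ℓe≡e = subst (λ w → (w ⊙ e) e) ℓe≡e (proj₂ (ℓ-unit e) refl)

  E-⊙-collapse : ∀ {e e' z} → E e → E e' → (e ⊙ e') z → e ≡ e' × e ≡ z
  E-⊙-collapse {e} {e'} {z} ℓe≡e ℓe'≡e' h
    with trans (sym (E⇒r-fixed ℓe≡e)) (trans (D⇒r≡ℓ e e' (z , h)) ℓe'≡e')
  ... | refl = refl , proj₂ (ℓ-absorbs {e} (subst (λ w → (w ⊙ e) z) (sym ℓe≡e) h))

  ⊙ˢ-comm-E : ∀ {P Q : Pred X 0ℓ} → P ⊆ E → Q ⊆ E → (P ⊙ˢ Q) ⊆ (Q ⊙ˢ P)
  ⊙ˢ-comm-E P⊆E Q⊆E (p , q , Pp , Qq , h) with E-⊙-collapse (P⊆E Pp) (Q⊆E Qq) h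
  ... | refl , _ = q , p , Qq , Pp , h

  ℓˢ-⊙ˢ : (A : Pred X 0ℓ) → (ℓˢ A ⊙ˢ A) ≐ A
  ℓˢ-⊙ˢ A = (λ { (_ , b , (a , _ , refl) , Ab , h) → subst A (proj₂ (ℓ-absorbs h)) Ab })
          , (λ {z} Az → ℓ z , z , (z , Az , refl) , Az , proj₂ (ℓ-unit z) refl)

  ℓˢ-⊙ˢ-distrib : (A B : Pred X 0ℓ) → ℓˢ (ℓˢ A ⊙ˢ B) ≐ (ℓˢ A ⊙ˢ ℓˢ B)
  ℓˢ-⊙ˢ-distrib A B = to , from
    where
    to : ℓˢ (ℓˢ A ⊙ˢ B) ⊆ (ℓˢ A ⊙ˢ ℓˢ B)
    to (_ , (_ , b , (a , Aa , refl) , Bb , h) , refl) with ℓ-absorbs h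
    ... | ℓa≡ℓb , refl = ℓ a , ℓ b , (a , Aa , refl) , (b , Bb , refl)
                       , subst (λ w → (w ⊙ ℓ b) (ℓ b)) (sym ℓa≡ℓb) (E-⊙-self (ℓ∈E b))
    from : (ℓˢ A ⊙ˢ ℓˢ B) ⊆ ℓˢ (ℓˢ A ⊙ˢ B)
    from (_ , _ , (a , Aa , refl) , (b , Bb , refl) , h) with E-⊙-collapse (ℓ∈E a) (ℓ∈E b) h
    ... | ℓa≡ℓb , refl = b , (ℓ a , b , (a , Aa , refl) , Bb
                       , subst (λ w → (w ⊙ b) b) (sym ℓa≡ℓb) (proj₂ (ℓ-unit b) refl))
                       , sym ℓa≡ℓb

  ⊙ˢ-opposite : (A B : Pred X 0ℓ) → LRMultimagma._⊙ˢ_ (opposite M) A B ≐ (B ⊙ˢ A)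
  ⊙ˢ-opposite A B = (λ (a , b , Aa , Bb , h) → b , a , Bb , Aa , h)
                  , (λ (b , a , Bb , Aa , h) → a , b , Aa , Bb , h)

module DualProperties (M : LRMultimagma) where
  open LRMultimagma M
  open Properties M
  private module Op = Properties (opposite M)

  r∈E : ∀ x → E (r x)
  r∈E = Op.ℓ∈r-fixed

  img-ℓ-or-r⊆E : ∀ {f : X → X} → (f ≡ ℓ ⊎ f ≡ r) → (A : Pred X 0ℓ) → img f A ⊆ E
  img-ℓ-or-r⊆E (inj₁ refl) = img⊆E ℓ∈E
  img-ℓ-or-r⊆E (inj₂ refl) = img⊆E r∈E

  ⊙ˢ-rˢ : (A : Pred X 0ℓ) → (A ⊙ˢ rˢ A) ≐ A
  ⊙ˢ-rˢ A = ≐-trans (≐-sym (⊙ˢ-opposite (rˢ A) A)) (Op.ℓˢ-⊙ˢ A)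

  rˢ-⊙ˢ-distrib : (A B : Pred X 0ℓ) → rˢ (A ⊙ˢ rˢ B) ≐ (rˢ A ⊙ˢ rˢ B)
  rˢ-⊙ˢ-distrib A B =
    ≐-trans (img-cong r (≐-sym (⊙ˢ-opposite (rˢ B) A)))
            (≐-trans (Op.ℓˢ-⊙ˢ-distrib B A) (⊙ˢ-opposite (rˢ B) (rˢ A)))

lemma6p2 : (M : LRMultimagma) → let open LRMultimagma M in
    (A B : Pred X 0ℓ) (𝒜 : Pred (Pred X 0ℓ) 0ℓ) →
      -- (1)
      ((ℓˢ (rˢ A) ≐ rˢ A) × (rˢ (ℓˢ A) ≐ ℓˢ A))
      -- (2)
    × ((ℓˢ A ⊙ˢ A) ≐ A × (A ⊙ˢ rˢ A) ≐ A)
      -- (3)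
    × ((ℓˢ (⋃ 𝒜) ≐ ⋃img ℓˢ 𝒜) × (rˢ (⋃ 𝒜) ≐ ⋃img rˢ 𝒜))
      -- (4)
    × ((ℓˢ (A ∪ B) ≐ (ℓˢ A ∪ ℓˢ B)) × (rˢ (A ∪ B) ≐ (rˢ A ∪ rˢ B))
       × (ℓˢ ∅ ≐ ∅) × (∅ ≐ rˢ ∅))
      -- (5)
    × (∀ (f g : X → X) → (f ≡ ℓ ⊎ f ≡ r) → (g ≡ ℓ ⊎ g ≡ r) →
         (img f A ⊙ˢ img g B) ≐ (img g B ⊙ˢ img f A))
      -- (6)
    × ((ℓˢ A ⊆ E) × (rˢ A ⊆ E))
      -- (7)
    × ((ℓˢ (ℓˢ A ⊙ˢ B) ≐ (ℓˢ A ⊙ˢ ℓˢ B)) × (rˢ (A ⊙ˢ rˢ B) ≐ (rˢ A ⊙ˢ rˢ B)))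
lemma6p2 M A B 𝒜 =
    (img-absorbs r∈E A , img-absorbs ℓ∈r-fixed A)
  , (ℓˢ-⊙ˢ A , ⊙ˢ-rˢ A)
  , (img-⋃ ℓ 𝒜 , img-⋃ r 𝒜)
  , (img-∪ ℓ A B , img-∪ r A B , img-∅ ℓ , ≐-sym (img-∅ r))
  , (λ f g f∈ℓr g∈ℓr → ⊙ˢ-comm-E (img-ℓ-or-r⊆E f∈ℓr A) (img-ℓ-or-r⊆E g∈ℓr B)
                     , ⊙ˢ-comm-E (img-ℓ-or-r⊆E g∈ℓr B) (img-ℓ-or-r⊆E f∈ℓr A))
  , (img⊆E ℓ∈E A , img⊆E r∈E A)
  , (ℓˢ-⊙ˢ-distrib A B , rˢ-⊙ˢ-distrib A B)
  where
  open LRMultimagma M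
  open Properties M
  open DualProperties M
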